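{- Let $K$ be an ap-bi-Kleene algebra (defined in the context), with $d(x)=a(a(x))$, $\langle x\rangle y=d(x\cdot y)$ and $[x]y=a(x\cdot a(y))$. Then for all $x,y\in K$ and all $p,q\in d(K)=\{d(z)\mid z\in K\}$: (1) $\langle x+y\rangle p=\langle x\rangle p+\langle y\rangle p$, $\langle x\cdot y\rangle p=\langle x\rangle\langle y\rangle p$, $\langle p\rangle q=p\cdot q$, $\langle x\|y\rangle p=\langle x\rangle p\cdot\langle y\rangle p$, $p+\langle x\rangle\langle x^\ast\rangle p=\langle x^\ast\rangle p$, and $\langle x\rangle p\le p\Rightarrow\langle x^\ast\rangle p\le p$; (2) $[x+y]p=[x]p\cdot[y]p$, $[x\cdot y]p=[x][y]p$, $[p]q=a(p)+q$, $[x\|y]p=[x]p+[y]p$, $p\cdot[x][x^\ast]p=[x^\ast]p$, and $p\le[x]p\Rightarrow p\le[x^\ast]p$.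
   Context: A proto-dioid is a structure $(S,+,\cdot,0,1_\sigma)$ such that $+$ is associative, commutative and idempotent with unit $0$ (ordered by $x\le y\iff x+y=y$), and $1_\sigma\cdot x=x$, $x\cdot 1_\sigma=x$, $x\cdot y+x\cdot z\le x\cdot(y+z)$, $(x+y)\cdot z=x\cdot z+y\cdot z$, $0\cdot x=0$ (multiplication need not be associative). A proto-trioid $(S,+,\cdot,\|,0,1_\sigma,1_\pi)$ is a proto-dioid such that $\|$ is associative and commutative with unit $1_\pi$, $x\|(y+z)=x\|y+x\|z$ and $x\|0=0$. An ap-dioid is a proto-dioid with a unary operation $a$ such that $x\cdot(y\cdot z)=(x\cdot y)\cdot z$ whenever one of $x,y,z$ equals $a(w)$ for some $w$, and $a(x)\cdot x=0$, $a(x\cdot y)=a(x\cdot a(a(y)))$, $a(x)+a(a(x))=1_\sigma$, $a(x)\cdot(y+z)=a(x)\cdot y+a(x)\cdot z$. An ap-trioid is an ap-dioid which is also a proto-trioid and satisfies $(x\|y)\cdot a(z)=(x\cdot a(z))\|(y\cdot a(z))$, $a(x\|y)=a(x)+a(y)$, $a(x)\|a(y)=a(x)\cdot a(y)$. An ap-Kleene algebra is an ap-dioid with a unary operation $^\ast$ satisfying $1_\sigma+x\cdot x^\ast\le x^\ast$ and $a(z)+x\cdot y\le y\Rightarrow x^\ast\cdot a(z)\le y$. An ap-bi-Kleene algebra is an ap-Kleene algebra which is also an ap-trioid. -}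

module Defs where

open import Level using (Level; suc)
open import Relation.Binary.PropositionalEquality using (_≡_)
open import Data.Product using (∃)

record ApBiKleene (c : Level) : Set (suc c) where
  infixl 6 _+_
  infixl 7 _·_
  infixl 7 _∥_
  infix 9 _*
  infix 4 _≤_
  field
    Carrier : Set c
    _+_ : Carrier → Carrier → Carrier
    _·_ : Carrier → Carrier → Carrier
    _∥_ : Carrier → Carrier → Carrier
    0# : Carrier
    1σ : Carrier
    1π : Carrier
    a : Carrier → Carrier
    _* : Carrier → Carrier

  _≤_ : Carrier → Carrier → Set c
  x ≤ y = x + y ≡ y

  field
    +-assoc : ∀ x y z → (x + y) + z ≡ x + (y + z)
    +-comm : ∀ x y → x + y ≡ y + x
    +-idem : ∀ x → x + x ≡ x
    +-identityˡ : ∀ x → 0# + x ≡ x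
    +-identityʳ : ∀ x → x + 0# ≡ x
    ·-identityˡ : ∀ x → 1σ · x ≡ x
    ·-identityʳ : ∀ x → x · 1σ ≡ x
    ·-subdistribˡ : ∀ x y z → x · y + x · z ≤ x · (y + z)
    ·-distribʳ : ∀ x y z → (x + y) · z ≡ x · z + y · z
    ·-zeroˡ : ∀ x → 0# · x ≡ 0#
    ∥-assoc : ∀ x y z → (x ∥ y) ∥ z ≡ x ∥ (y ∥ z)
    ∥-comm : ∀ x y → x ∥ y ≡ y ∥ x
    ∥-identityˡ : ∀ x → 1π ∥ x ≡ x
    ∥-identityʳ : ∀ x → x ∥ 1π ≡ x
    ∥-distribˡ : ∀ x y z → x ∥ (y + z) ≡ x ∥ y + x ∥ z
    ∥-zeroʳ : ∀ x → x ∥ 0# ≡ 0#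
    ·-assoc-a₁ : ∀ w y z → a w · (y · z) ≡ (a w · y) · z
    ·-assoc-a₂ : ∀ x w z → x · (a w · z) ≡ (x · a w) · z
    ·-assoc-a₃ : ∀ x y w → x · (y · a w) ≡ (x · y) · a w
    a-annihil : ∀ x → a x · x ≡ 0#
    a-local : ∀ x y → a (x · y) ≡ a (x · a (a y))
    a-compl : ∀ x → a x + a (a x) ≡ 1σ
    a-distribˡ : ∀ x y z → a x · (y + z) ≡ a x · y + a x · z
    ∥-·-a : ∀ x y z → (x ∥ y) · a z ≡ (x · a z) ∥ (y · a z)
    a-∥ : ∀ x y → a (x ∥ y) ≡ a x + a y
    a-∥-· : ∀ x y → a x ∥ a y ≡ a x · a y
    *-unfold : ∀ x → 1σ + x · (x *) ≤ x *
    *-induct : ∀ x y z → a z + x · y ≤ y → (x *) · a z ≤ y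

  d : Carrier → Carrier
  d x = a (a x)

  IsDom : Carrier → Set c
  IsDom p = ∃ λ z → p ≡ d z

  ⟨_⟩_ : Carrier → Carrier → Carrier
  ⟨ x ⟩ y = d (x · y)

  [_]_ : Carrier → Carrier → Carrier
  [ x ] y = a (x · a y)

-- The antidomain elements a s (the tests) behave like a Boolean algebra inside K:
-- a (x + y) = a x · a y and a (a x · a y) = d x + d y, where the only associativity
-- and distributivity used is the one the axioms grant when a test is involved.
-- The diamond laws follow by pushing d through +, · and ∥. For the star laws,
-- star induction guarded by a s is applied to y = r · (x * · a s) for a test r,
-- which bounds ⟨ x * ⟩ a s by d y ≤ r. The box laws are the de Morgan duals,
-- since [ x ] p = a (⟨ x ⟩ a p).
module Submission where

open import Defs
open import Level using (Level)
open import Relation.Binary.PropositionalEquality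
  using (_≡_; refl; sym; trans; cong; cong₂; subst; isEquivalence)
open import Relation.Binary.Bundles using (Poset)
open import Data.Product using (_×_; _,_)

module ApBiKleeneProperties {c : Level} (K : ApBiKleene c) where
  open ApBiKleene K

  ≤-reflexive : ∀ {x y} → x ≡ y → x ≤ y
  ≤-reflexive {x} refl = +-idem x

  ≤-trans : ∀ {x y z} → x ≤ y → y ≤ z → x ≤ z
  ≤-trans {x} {y} {z} x≤y y≤z =
    trans (cong (x +_) (sym y≤z))
      (trans (sym (+-assoc x y z)) (trans (cong (_+ z) x≤y) y≤z))

  ≤-antisym : ∀ {x y} → x ≤ y → y ≤ x → x ≡ y
  ≤-antisym {x} {y} x≤y y≤x = trans (sym y≤x) (trans (+-comm y x) x≤y)

  ≤-poset : Poset c c c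
  ≤-poset = record
    { _≈_ = _≡_
    ; _≤_ = _≤_
    ; isPartialOrder = record
      { isPreorder = record
        { isEquivalence = isEquivalence
        ; reflexive = ≤-reflexive
        ; trans = ≤-trans
        }
      ; antisym = ≤-antisym
      }
    }

  open import Relation.Binary.Reasoning.PartialOrder ≤-poset

  x≤x+y : ∀ x y → x ≤ x + y
  x≤x+y x y = trans (sym (+-assoc x x y)) (cong (_+ y) (+-idem x))

  y≤x+y : ∀ x y → y ≤ x + y
  y≤x+y x y = subst (y ≤_) (+-comm y x) (x≤x+y y x)

  +-lub : ∀ {x y z} → x ≤ z → y ≤ z → x + y ≤ z
  +-lub {x} {y} {z} x≤z y≤z = trans (+-assoc x y z) (trans (cong (x +_) y≤z) x≤z)

  x≤0⇒x≡0 : ∀ {x} → x ≤ 0# → x ≡ 0#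
  x≤0⇒x≡0 {x} x≤0 = trans (sym (+-identityʳ x)) x≤0

  ·-monoˡ-≤ : ∀ z {x y} → x ≤ y → x · z ≤ y · z
  ·-monoˡ-≤ z {x} {y} x≤y = trans (sym (·-distribʳ x y z)) (cong (_· z) x≤y)

  ·-monoʳ-≤ : ∀ x {y z} → y ≤ z → x · y ≤ x · z
  ·-monoʳ-≤ x {y} {z} y≤z = begin
    x · y          ≤⟨ x≤x+y (x · y) (x · z) ⟩
    x · y + x · z  ≤⟨ ·-subdistribˡ x y z ⟩
    x · (y + z)    ≡⟨ cong (x ·_) y≤z ⟩
    x · z          ∎

  ·-mono-≤ : ∀ {x y u v} → x ≤ y → u ≤ v → x · u ≤ y · v
  ·-mono-≤ {y = y} {u} x≤y u≤v = ≤-trans (·-monoˡ-≤ u x≤y) (·-monoʳ-≤ y u≤v)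

  a≤1 : ∀ x → a x ≤ 1σ
  a≤1 x = subst (a x ≤_) (a-compl x) (x≤x+y (a x) (d x))

  a·≤ : ∀ x y → a x · y ≤ y
  a·≤ x y = begin
    a x · y  ≤⟨ ·-monoˡ-≤ y (a≤1 x) ⟩
    1σ · y   ≡⟨ ·-identityˡ y ⟩
    y        ∎

  ·a≤ : ∀ x y → y · a x ≤ y
  ·a≤ x y = begin
    y · a x  ≤⟨ ·-monoʳ-≤ y (a≤1 x) ⟩
    y · 1σ   ≡⟨ ·-identityʳ y ⟩
    y        ∎

  d·x≡x : ∀ x → d x · x ≡ x
  d·x≡x x = begin-equality
    d x · x            ≡⟨ +-identityˡ (d x · x) ⟨
    0# + d x · x       ≡⟨ cong (_+ d x · x) (a-annihil x) ⟨
    a x · x + d x · x  ≡⟨ ·-distribʳ (a x) (d x) x ⟨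
    (a x + d x) · x    ≡⟨ cong (_· x) (a-compl x) ⟩
    1σ · x             ≡⟨ ·-identityˡ x ⟩
    x                  ∎

  a-d≡a : ∀ x → a (d x) ≡ a x
  a-d≡a x = begin-equality
    a (d x)       ≡⟨ cong a (·-identityˡ (d x)) ⟨
    a (1σ · d x)  ≡⟨ a-local 1σ x ⟨
    a (1σ · x)    ≡⟨ cong a (·-identityˡ x) ⟩
    a x           ∎

  a1≡0 : a 1σ ≡ 0#
  a1≡0 = trans (sym (·-identityʳ (a 1σ))) (a-annihil 1σ)

  a0≡1 : a 0# ≡ 1σ
  a0≡1 = begin-equality
    a 0#         ≡⟨ cong a a1≡0 ⟨
    d 1σ         ≡⟨ ·-identityʳ (d 1σ) ⟨
    d 1σ · 1σ    ≡⟨ d·x≡x 1σ ⟩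
    1σ           ∎

  a≡1⇒≡0 : ∀ {x} → a x ≡ 1σ → x ≡ 0#
  a≡1⇒≡0 {x} ax≡1 = begin-equality
    x            ≡⟨ d·x≡x x ⟨
    a (a x) · x  ≡⟨ cong (λ w → a w · x) ax≡1 ⟩
    a 1σ · x     ≡⟨ cong (_· x) a1≡0 ⟩
    0# · x       ≡⟨ ·-zeroˡ x ⟩
    0#           ∎

  ·≡0⇒·d≡0 : ∀ {x y} → x · y ≡ 0# → x · d y ≡ 0#
  ·≡0⇒·d≡0 {x} {y} x·y≡0 = a≡1⇒≡0 (begin-equality
    a (x · d y)  ≡⟨ a-local x y ⟨
    a (x · y)    ≡⟨ cong a x·y≡0 ⟩
    a 0#         ≡⟨ a0≡1 ⟩
    1σ           ∎)

  a·d≡0 : ∀ x → a x · d x ≡ 0#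
  a·d≡0 x = ·≡0⇒·d≡0 (a-annihil x)

  LeftDistributive : Carrier → Set c
  LeftDistributive t = ∀ y z → t · (y + z) ≡ t · y + t · z

  -- Left multiplication is in general only subdistributive, hence the hypothesis on t.
  ·a-absorb : ∀ {t} → LeftDistributive t → ∀ y → t · d y ≡ 0# → t · a y ≡ t
  ·a-absorb {t} t-distrib y t·dy≡0 = begin-equality
    t · a y            ≡⟨ +-identityʳ (t · a y) ⟨
    t · a y + 0#       ≡⟨ cong (t · a y +_) t·dy≡0 ⟨
    t · a y + t · d y  ≡⟨ t-distrib (a y) (d y) ⟨
    t · (a y + d y)    ≡⟨ cong (t ·_) (a-compl y) ⟩
    t · 1σ             ≡⟨ ·-identityʳ t ⟩
    t                  ∎

  a·a-distribˡ : ∀ u v → LeftDistributive (a u · a v)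
  a·a-distribˡ u v y z = begin-equality
    (a u · a v) · (y + z)              ≡⟨ ·-assoc-a₁ u (a v) (y + z) ⟨
    a u · (a v · (y + z))              ≡⟨ cong (a u ·_) (a-distribˡ v y z) ⟩
    a u · (a v · y + a v · z)          ≡⟨ a-distribˡ u (a v · y) (a v · z) ⟩
    a u · (a v · y) + a u · (a v · z)  ≡⟨ cong₂ _+_ (·-assoc-a₁ u (a v) y) (·-assoc-a₁ u (a v) z) ⟩
    (a u · a v) · y + (a u · a v) · z  ∎

  a-idem : ∀ x → a x · a x ≡ a x
  a-idem x = ·a-absorb (a-distribˡ x) x (a·d≡0 x)

  a·≡0⇒a≤a : ∀ {x y} → a x · y ≡ 0# → a x ≤ a y
  a·≡0⇒a≤a {x} {y} ax·y≡0 = begin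
    a x        ≡⟨ ·a-absorb (a-distribˡ x) y (·≡0⇒·d≡0 ax·y≡0) ⟨
    a x · a y  ≤⟨ a·≤ x (a y) ⟩
    a y        ∎

  a-antitone : ∀ {x y} → x ≤ y → a y ≤ a x
  a-antitone {x} {y} x≤y = a·≡0⇒a≤a (x≤0⇒x≡0 (begin
    a y · x  ≤⟨ ·-monoʳ-≤ (a y) x≤y ⟩
    a y · y  ≡⟨ a-annihil y ⟩
    0#       ∎))

  d-mono : ∀ {x y} → x ≤ y → d x ≤ d y
  d-mono x≤y = a-antitone (a-antitone x≤y)

  a-+ : ∀ x y → a (x + y) ≡ a x · a y
  a-+ x y = ≤-antisym a[x+y]≤ax·ay ax·ay≤a[x+y]
    where
    a[x+y]≤ax·ay : a (x + y) ≤ a x · a y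
    a[x+y]≤ax·ay = begin
      a (x + y)              ≡⟨ a-idem (x + y) ⟨
      a (x + y) · a (x + y)  ≤⟨ ·-mono-≤ (a-antitone (x≤x+y x y)) (a-antitone (y≤x+y x y)) ⟩
      a x · a y              ∎

    ax·ay·[x+y]≡0 : (a x · a y) · (x + y) ≡ 0#
    ax·ay·[x+y]≡0 = x≤0⇒x≡0 (begin
      (a x · a y) · (x + y)              ≡⟨ a·a-distribˡ x y x y ⟩
      (a x · a y) · x + (a x · a y) · y  ≤⟨ +-lub ax·ay·x≤0 ax·ay·y≤0 ⟩
      0#                                 ∎)
      where
      ax·ay·x≤0 : (a x · a y) · x ≤ 0#
      ax·ay·x≤0 = ≤-trans (·-monoˡ-≤ x (·a≤ y (a x))) (≤-reflexive (a-annihil x))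
      ax·ay·y≤0 : (a x · a y) · y ≤ 0#
      ax·ay·y≤0 = ≤-trans (·-monoˡ-≤ y (a·≤ x (a y))) (≤-reflexive (a-annihil y))

    ax·ay≤a[x+y] : a x · a y ≤ a (x + y)
    ax·ay≤a[x+y] = begin
      a x · a y                ≡⟨ ·a-absorb (a·a-distribˡ x y) (x + y) (·≡0⇒·d≡0 ax·ay·[x+y]≡0) ⟨
      (a x · a y) · a (x + y)  ≡⟨ ·-assoc-a₁ x (a y) (a (x + y)) ⟨
      a x · (a y · a (x + y))  ≤⟨ a·≤ x (a y · a (x + y)) ⟩
      a y · a (x + y)          ≤⟨ a·≤ y (a (x + y)) ⟩
      a (x + y)                ∎

  +≡1⇒a≤ : ∀ {s r} → s + r ≡ 1σ → a s ≤ r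
  +≡1⇒a≤ {s} {r} s+r≡1 = begin
    a s                ≡⟨ ·-identityʳ (a s) ⟨
    a s · 1σ           ≡⟨ cong (a s ·_) s+r≡1 ⟨
    a s · (s + r)      ≡⟨ a-distribˡ s s r ⟩
    a s · s + a s · r  ≡⟨ cong (_+ a s · r) (a-annihil s) ⟩
    0# + a s · r       ≡⟨ +-identityˡ (a s · r) ⟩
    a s · r            ≤⟨ a·≤ s r ⟩
    r                  ∎

  a-deMorgan : ∀ x y → a (a x · a y) ≡ d x + d y
  a-deMorgan x y = ≤-antisym (+≡1⇒a≤ complement) d+d≤a[a·a]
    where
    1≤complement : 1σ ≤ a x · a y + (d x + d y)
    1≤complement = begin
      1σ                             ≡⟨ a-compl x ⟨
      a x + d x                      ≡⟨ cong (_+ d x) (·-identityʳ (a x)) ⟨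
      a x · 1σ + d x                 ≡⟨ cong (λ w → a x · w + d x) (a-compl y) ⟨
      a x · (a y + d y) + d x        ≡⟨ cong (_+ d x) (a-distribˡ x (a y) (d y)) ⟩
      (a x · a y + a x · d y) + d x  ≤⟨ +-lub (+-lub (x≤x+y _ _) ax·dy≤) dx≤ ⟩
      a x · a y + (d x + d y)        ∎
      where
      ax·dy≤ : a x · d y ≤ a x · a y + (d x + d y)
      ax·dy≤ = ≤-trans (a·≤ x (d y)) (≤-trans (y≤x+y (d x) (d y)) (y≤x+y _ _))
      dx≤ : d x ≤ a x · a y + (d x + d y)
      dx≤ = ≤-trans (x≤x+y (d x) (d y)) (y≤x+y _ _)

    complement : a x · a y + (d x + d y) ≡ 1σ
    complement = ≤-antisym
      (+-lub (≤-trans (·a≤ y (a x)) (a≤1 x)) (+-lub (a≤1 (a x)) (a≤1 (a y))))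
      1≤complement

    d+d≤a[a·a] : d x + d y ≤ a (a x · a y)
    d+d≤a[a·a] = +-lub (a-antitone (·a≤ y (a x))) (a-antitone (a·≤ x (a y)))

  d-+ : ∀ x y → d (x + y) ≡ d x + d y
  d-+ x y = trans (cong a (a-+ x y)) (a-deMorgan x y)

  d-∥ : ∀ x y → d (x ∥ y) ≡ d x · d y
  d-∥ x y = trans (cong a (a-∥ x y)) (a-+ (a x) (a y))

  d·≤d : ∀ x y → d (x · y) ≤ d x
  d·≤d x y = a-antitone (a·≡0⇒a≤a (begin-equality
    a x · (x · y)  ≡⟨ ·-assoc-a₁ x x y ⟩
    (a x · x) · y  ≡⟨ cong (_· y) (a-annihil x) ⟩
    0# · y         ≡⟨ ·-zeroˡ y ⟩
    0#             ∎))

  1≤x* : ∀ x → 1σ ≤ x *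
  1≤x* x = ≤-trans (x≤x+y 1σ (x · x *)) (*-unfold x)

  x·x*≤x* : ∀ x → x · x * ≤ x *
  x·x*≤x* x = ≤-trans (y≤x+y 1σ (x · x *)) (*-unfold x)

  a≤x*·a : ∀ x s → a s ≤ x * · a s
  a≤x*·a x s = begin
    a s         ≡⟨ ·-identityˡ (a s) ⟨
    1σ · a s    ≤⟨ ·-monoˡ-≤ (a s) (1≤x* x) ⟩
    x * · a s   ∎

  ⟨⟩-+ : ∀ x y p → ⟨ x + y ⟩ p ≡ (⟨ x ⟩ p) + (⟨ y ⟩ p)
  ⟨⟩-+ x y p = trans (cong d (·-distribʳ x y p)) (d-+ (x · p) (y · p))

  ⟨⟩-· : ∀ x y s → ⟨ x · y ⟩ a s ≡ ⟨ x ⟩ ⟨ y ⟩ a s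
  ⟨⟩-· x y s = trans (cong d (sym (·-assoc-a₃ x y s))) (cong a (a-local x (y · a s)))

  ⟨a⟩a≡a·a : ∀ s t → ⟨ a s ⟩ a t ≡ a s · a t
  ⟨a⟩a≡a·a s t = begin-equality
    d (a s · a t)  ≡⟨ cong d (a-+ s t) ⟨
    d (a (s + t))  ≡⟨ a-d≡a (s + t) ⟩
    a (s + t)      ≡⟨ a-+ s t ⟩
    a s · a t      ∎

  ⟨⟩-∥ : ∀ x y s → ⟨ x ∥ y ⟩ a s ≡ (⟨ x ⟩ a s) · (⟨ y ⟩ a s)
  ⟨⟩-∥ x y s = trans (cong d (∥-·-a x y s)) (d-∥ (x · a s) (y · a s))

  ⟨*⟩-bound : ∀ x s t → a s ≤ a t →
    x · (a t · (x * · a s)) ≤ a t · (x * · a s) → ⟨ x * ⟩ a s ≤ a t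
  ⟨*⟩-bound x s t as≤at step = begin
    d (x * · a s)          ≤⟨ d-mono (*-induct x (a t · (x * · a s)) s (+-lub base step)) ⟩
    d (a t · (x * · a s))  ≤⟨ d·≤d (a t) (x * · a s) ⟩
    d (a t)                ≡⟨ a-d≡a t ⟩
    a t                    ∎
    where
    base : a s ≤ a t · (x * · a s)
    base = begin
      a s                ≡⟨ a-idem s ⟨
      a s · a s          ≤⟨ ·-mono-≤ as≤at (a≤x*·a x s) ⟩
      a t · (x * · a s)  ∎

  ⟨*⟩-unfold : ∀ x s → a s + ⟨ x ⟩ ⟨ x * ⟩ a s ≡ ⟨ x * ⟩ a s
  ⟨*⟩-unfold x s = begin-equality
    a s + ⟨ x ⟩ ⟨ x * ⟩ a s  ≡⟨ cong (a s +_) (⟨⟩-· x (x *) s) ⟨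
    a s + d m                ≡⟨ ≤-antisym unfold≤ ≤unfold ⟩
    ⟨ x * ⟩ a s              ∎
    where
    m : Carrier
    m = (x · x *) · a s

    unfold≤ : a s + d m ≤ ⟨ x * ⟩ a s
    unfold≤ = +-lub
      (subst (_≤ ⟨ x * ⟩ a s) (a-d≡a s) (d-mono (a≤x*·a x s)))
      (d-mono (·-monoˡ-≤ (a s) (x·x*≤x* x)))

    t : Carrier
    t = d s · a m

    at≡ : a t ≡ a s + d m
    at≡ = trans (a-deMorgan (a s) m) (cong (_+ d m) (a-d≡a s))

    step : x · (a t · (x * · a s)) ≤ a t · (x * · a s)
    step = begin
      x · (a t · (x * · a s))  ≤⟨ ·-monoʳ-≤ x (a·≤ t (x * · a s)) ⟩
      x · (x * · a s)          ≡⟨ ·-assoc-a₃ x (x *) s ⟩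
      m                        ≡⟨ d·x≡x m ⟨
      d m · m                  ≤⟨ ·-mono-≤ dm≤at (·-monoˡ-≤ (a s) (x·x*≤x* x)) ⟩
      a t · (x * · a s)        ∎
      where
      dm≤at : d m ≤ a t
      dm≤at = subst (d m ≤_) (sym at≡) (y≤x+y (a s) (d m))

    ≤unfold : ⟨ x * ⟩ a s ≤ a s + d m
    ≤unfold = begin
      ⟨ x * ⟩ a s  ≤⟨ ⟨*⟩-bound x s t (subst (a s ≤_) (sym at≡) (x≤x+y (a s) (d m))) step ⟩
      a t          ≡⟨ at≡ ⟩
      a s + d m    ∎

  ⟨*⟩-induct : ∀ x s → ⟨ x ⟩ a s ≤ a s → ⟨ x * ⟩ a s ≤ a s
  ⟨*⟩-induct x s ⟨x⟩as≤as = ⟨*⟩-bound x s s (≤-reflexive refl) (begin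
    x · (a s · w)                    ≡⟨ ·-assoc-a₂ x s w ⟩
    (x · a s) · w                    ≡⟨ cong (_· w) (d·x≡x (x · a s)) ⟨
    (d (x · a s) · (x · a s)) · w    ≤⟨ ·-monoˡ-≤ w (·-monoˡ-≤ (x · a s) ⟨x⟩as≤as) ⟩
    (a s · (x · a s)) · w            ≡⟨ ·-assoc-a₁ s (x · a s) w ⟨
    a s · ((x · a s) · w)            ≡⟨ cong (a s ·_) (·-assoc-a₂ x s w) ⟨
    a s · (x · (a s · w))            ≤⟨ ·-monoʳ-≤ (a s) (·-monoʳ-≤ x (a·≤ s w)) ⟩
    a s · (x · w)                    ≡⟨ cong (a s ·_) (·-assoc-a₃ x (x *) s) ⟩
    a s · ((x · x *) · a s)          ≤⟨ ·-monoʳ-≤ (a s) (·-monoˡ-≤ (a s) (x·x*≤x* x)) ⟩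
    a s · w                          ∎)
    where
    w : Carrier
    w = x * · a s

  []≡a⟨⟩a : ∀ x p → [ x ] p ≡ a (⟨ x ⟩ a p)
  []≡a⟨⟩a x p = sym (a-d≡a (x · a p))

  []-+ : ∀ x y p → [ x + y ] p ≡ ([ x ] p) · ([ y ] p)
  []-+ x y p = trans (cong a (·-distribʳ x y (a p))) (a-+ (x · a p) (y · a p))

  []-· : ∀ x y p → [ x · y ] p ≡ [ x ] [ y ] p
  []-· x y p = trans (cong a (sym (·-assoc-a₃ x y p))) (a-local x (y · a p))

  [a]a≡a+a : ∀ s t → [ a s ] a t ≡ a (a s) + a t
  [a]a≡a+a s t = trans (a-deMorgan s (a t)) (cong (d s +_) (a-d≡a t))

  []-∥ : ∀ x y p → [ x ∥ y ] p ≡ ([ x ] p) + ([ y ] p)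
  []-∥ x y p = trans (cong a (∥-·-a x y p)) (a-∥ (x · a p) (y · a p))

  [*]-unfold : ∀ x s → a s · [ x ] [ x * ] a s ≡ [ x * ] a s
  [*]-unfold x s = begin-equality
    a s · [ x ] [ x * ] a s    ≡⟨ cong₂ _·_ (sym (a-d≡a s)) ([]≡a⟨⟩a x ([ x * ] a s)) ⟩
    a p · a (⟨ x ⟩ ⟨ x * ⟩ p)  ≡⟨ a-+ p (⟨ x ⟩ ⟨ x * ⟩ p) ⟨
    a (p + ⟨ x ⟩ ⟨ x * ⟩ p)    ≡⟨ cong a (⟨*⟩-unfold x (a s)) ⟩
    a (⟨ x * ⟩ p)              ≡⟨ []≡a⟨⟩a (x *) (a s) ⟨
    [ x * ] a s                ∎
    where
    p : Carrier
    p = a (a s)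

  [*]-induct : ∀ x s → a s ≤ [ x ] a s → a s ≤ [ x * ] a s
  [*]-induct x s as≤[x]as = begin
    a s                    ≡⟨ a-d≡a s ⟨
    a (d s)                ≤⟨ a-antitone (⟨*⟩-induct x (a s) (a-antitone as≤[x]as)) ⟩
    a (⟨ x * ⟩ a (a s))    ≡⟨ []≡a⟨⟩a (x *) (a s) ⟨
    [ x * ] a s            ∎

theorem12p3 : ∀ {c : Level} (K : ApBiKleene c) → let open ApBiKleene K in
    ∀ (x y p q : Carrier) → IsDom p → IsDom q →
      ((⟨ x + y ⟩ p) ≡ (⟨ x ⟩ p) + (⟨ y ⟩ p)
      × (⟨ x · y ⟩ p) ≡ (⟨ x ⟩ (⟨ y ⟩ p))
      × (⟨ p ⟩ q) ≡ p · q
      × (⟨ x ∥ y ⟩ p) ≡ (⟨ x ⟩ p) · (⟨ y ⟩ p)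
      × p + (⟨ x ⟩ (⟨ x * ⟩ p)) ≡ (⟨ x * ⟩ p)
      × ((⟨ x ⟩ p) ≤ p → (⟨ x * ⟩ p) ≤ p))
      ×
      (([ x + y ] p) ≡ ([ x ] p) · ([ y ] p)
      × ([ x · y ] p) ≡ ([ x ] ([ y ] p))
      × ([ p ] q) ≡ a p + q
      × ([ x ∥ y ] p) ≡ ([ x ] p) + ([ y ] p)
      × p · ([ x ] ([ x * ] p)) ≡ ([ x * ] p)
      × (p ≤ ([ x ] p) → p ≤ ([ x * ] p)))
theorem12p3 K x y .(ApBiKleene.d K z) .(ApBiKleene.d K w) (z , refl) (w , refl) =
  ( ⟨⟩-+ x y p , ⟨⟩-· x y s , ⟨a⟩a≡a·a s t , ⟨⟩-∥ x y s , ⟨*⟩-unfold x s , ⟨*⟩-induct x s )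
  , ( []-+ x y p , []-· x y p , [a]a≡a+a s t , []-∥ x y p , [*]-unfold x s , [*]-induct x s )
  where
  open ApBiKleene K
  open ApBiKleeneProperties K
  s t p : Carrier
  s = a z
  t = a w
  p = a s
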